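{- Let $p\equiv 1 \pmod 4$ be a prime number, let $k$ be an even positive integer, and let $q_k$ be a prime with $q_k \equiv 1 \pmod 4$, $\left(\frac{p}{q_k}\right)=-1$, $q_k^2 \not\equiv p \pmod{16}$ and $p^k < q_k < 2p^k$. Then $16 \nmid p^{\lceil \log_p(q_k^2)\rceil} - q_k^2$ and $16 \nmid 2p^{\lceil\log_p(2q_k^2)\rceil} - 4q_k^2$.
   Context: $\left(\frac{p}{q}\right)$ denotes the Legendre symbol; $\lceil\cdot\rceil$ is the ceiling function. -}

module Defs where

open import Data.Nat using (ℕ; zero; suc; _^_; _*_; _≤_; _≤?_; NonZero)
open import Data.Nat.DivMod using (_%_)
open import Data.Nat.Divisibility using (_∣_)
open import Data.Product using (∃; _×_)
open import Relation.Binary.PropositionalEquality using (_≡_)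
open import Relation.Nullary using (¬_; yes; no)

-- Legendre symbol condition (a / q) = -1 for an odd prime q:
-- q does not divide a, and a is not a square modulo q.
LegendreMinusOne : (a q : ℕ) → .{{NonZero q}} → Set
LegendreMinusOne a q = ¬ (q ∣ a) × ¬ (∃ λ x → (x * x) % q ≡ a % q)

-- ⌈log_b n⌉ for b ≥ 2, n ≥ 1: the least e with n ≤ b ^ e.
-- Search e = 0, 1, …; 'fuel' bounds the search (fuel n suffices as b ^ n ≥ n).
ceilLogFrom : (b n e fuel : ℕ) → ℕ
ceilLogFrom b n e zero = e
ceilLogFrom b n e (suc fuel) with n ≤? b ^ e
... | yes _ = e
... | no _ = ceilLogFrom b n (suc e) fuel

ceilLog : (b n : ℕ) → ℕ
ceilLog b n = ceilLogFrom b n 0 n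

-- Write P = p ^ k.  From P < q < 2P we get p ^ (2k) < q² < 4 p ^ (2k) ≤ p ^ (2k+1), so
-- ⌈log_p q²⌉ = 2k + 1 ≡ 1 (mod 4) as k is even.  Odd fourth powers are 1 mod 16, hence
-- p ^ (2k+1) ≡ p (mod 16), and 16 ∣ p ^ (2k+1) − q² would give q² ≡ p (mod 16).  The second
-- number is 2 · odd − 4 · q² ≡ 2 (mod 4), so not even 4 divides it.  Only the hypotheses
-- q² ≢ p (mod 16) and P < q < 2P are needed.
module Submission where

open import Defs
open import Data.Nat using (ℕ; _^_; _*_; _<_; _≤_; _%_; NonZero)
open import Data.Nat.Primality using (Prime)
open import Data.Nat.Divisibility using (_∣_)
open import Data.Integer using (ℤ; +_; _-_)
open import Data.Product using (_×_)
open import Relation.Binary.PropositionalEquality using (_≡_; _≢_)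
open import Relation.Nullary using (¬_)
import Data.Integer.Divisibility as ℤDiv

open import Data.Nat using (zero; suc; _+_; _∸_; z≤n; s≤s; z<s; _≤?_)
open import Data.Nat.Properties
open import Data.Nat.DivMod
open import Data.Nat.Divisibility using (divides; ∣-trans)
open import Data.Nat.Primality using (prime⇒nonTrivial)
open import Data.Nat.Base using (nonTrivial⇒n>1; >-nonZero)
open import Data.Nat.Solver using (module +-*-Solver)
open import Data.Fin using (Fin; toℕ; fromℕ<)
open import Data.Fin.Properties using (all?; toℕ-fromℕ<)
import Data.Integer as ℤ
import Data.Integer.Properties as ℤ
open import Data.Product using (_,_)
open import Data.Sum using (inj₁; inj₂)
open import Relation.Nullary using (yes; no)
open import Relation.Nullary.Decidable using (from-yes; _→-dec_)
open import Relation.Binary.PropositionalEquality using (refl; sym; trans; cong; subst; module ≡-Reasoning)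

n<m^n : ∀ m → 1 < m → ∀ n → n < m ^ n
n<m^n m 1<m zero    = s≤s z≤n
n<m^n m 1<m (suc n) = ≤-trans (s≤s (n<m^n m 1<m n)) (^-monoʳ-< m 1<m (n<1+n n))

ceilLogFrom-≡ : ∀ b n E e fuel → e ≤ E → E ≤ e + fuel →
  (∀ {i} → i < E → b ^ i < n) → n ≤ b ^ E → ceilLogFrom b n e fuel ≡ E
ceilLogFrom-≡ b n E e zero e≤E E≤e+0 below n≤b^E =
  ≤-antisym e≤E (subst (E ≤_) (+-identityʳ e) E≤e+0)
ceilLogFrom-≡ b n E e (suc fuel) e≤E E≤e+fuel below n≤b^E with n ≤? b ^ e
... | yes n≤b^e = ≤-antisym e≤E (≮⇒≥ λ e<E → <⇒≱ (below e<E) n≤b^e)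
... | no n≰b^e  = ceilLogFrom-≡ b n E (suc e) fuel e<E (subst (E ≤_) (+-suc e fuel) E≤e+fuel)
                    below n≤b^E
  where
  e<E : e < E
  e<E = ≤∧≢⇒< e≤E λ { refl → n≰b^e n≤b^E }

ceilLog-≡ : ∀ b d n → 1 < b → b ^ d < n → n ≤ b ^ suc d → ceilLog b n ≡ suc d
ceilLog-≡ b d n 1<b b^d<n n≤b^[1+d] =
  ceilLogFrom-≡ b n (suc d) 0 n z≤n (<-trans (n<m^n b 1<b d) b^d<n) below n≤b^[1+d]
  where
  below : ∀ {i} → i < suc d → b ^ i < n
  below (s≤s i≤d) = ≤-<-trans (^-monoʳ-≤ b {{>-nonZero (<-trans z<s 1<b)}} i≤d) b^d<n

ceilLog-sq : ∀ b k q → 4 ≤ b → b ^ k < q → q < 2 * b ^ k → ceilLog b (q * q) ≡ suc (k + k)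
ceilLog-sq b k q 4≤b b^k<q q<2b^k = ceilLog-≡ b (k + k) (q * q) (<-≤-trans (s≤s (s≤s z≤n)) 4≤b)
  (subst (_< q * q) (sym b^[k+k]) (*-mono-< b^k<q b^k<q))
  (begin
    q * q                       <⟨ *-mono-< q<2b^k q<2b^k ⟩
    2 * b ^ k * (2 * b ^ k)     ≡⟨ double-sq (b ^ k) ⟩
    4 * (b ^ k * b ^ k)         ≤⟨ *-monoˡ-≤ (b ^ k * b ^ k) 4≤b ⟩
    b * (b ^ k * b ^ k)         ≡⟨ cong (b *_) (sym b^[k+k]) ⟩
    b ^ suc (k + k)             ∎)
  where
  open ≤-Reasoning
  open +-*-Solver
  b^[k+k] : b ^ (k + k) ≡ b ^ k * b ^ k
  b^[k+k] = ^-distribˡ-+-* b k k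
  double-sq : ∀ x → 2 * x * (2 * x) ≡ 4 * (x * x)
  double-sq = solve 1 (λ x → con 2 :* x :* (con 2 :* x) := con 4 :* (x :* x)) refl

%-distribˡ-^ : ∀ m n d .{{_ : NonZero d}} → m ^ n % d ≡ (m % d) ^ n % d
%-distribˡ-^ m zero    d = refl
%-distribˡ-^ m (suc n) d = begin
  m * m ^ n % d                         ≡⟨ %-distribˡ-* m (m ^ n) d ⟩
  m % d * (m ^ n % d) % d               ≡⟨ cong (λ x → m % d * x % d) (%-distribˡ-^ m n d) ⟩
  m % d * ((m % d) ^ n % d) % d         ≡⟨ cong (λ x → x * ((m % d) ^ n % d) % d) (sym (m%n%n≡m%n m d)) ⟩
  m % d % d * ((m % d) ^ n % d) % d     ≡⟨ sym (%-distribˡ-* (m % d) ((m % d) ^ n) d) ⟩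
  m % d * (m % d) ^ n % d               ∎
  where open ≡-Reasoning

odd⇒^4%16≡1 : ∀ m → m % 2 ≡ 1 → m ^ 4 % 16 ≡ 1
odd⇒^4%16≡1 m m-odd = begin
  m ^ 4 % 16          ≡⟨ %-distribˡ-^ m 4 16 ⟩
  (m % 16) ^ 4 % 16   ≡⟨ cong (λ x → x ^ 4 % 16) (sym (toℕ-fromℕ< m%16<16)) ⟩
  toℕ r ^ 4 % 16      ≡⟨ residues r (subst (λ x → x % 2 ≡ 1) (sym (toℕ-fromℕ< m%16<16)) r-odd) ⟩
  1                   ∎
  where
  open ≡-Reasoning
  residues : ∀ (s : Fin 16) → toℕ s % 2 ≡ 1 → toℕ s ^ 4 % 16 ≡ 1
  residues = from-yes (all? {n = 16} λ s → (toℕ s % 2 ≟ 1) →-dec (toℕ s ^ 4 % 16 ≟ 1))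
  m%16<16 : m % 16 < 16
  m%16<16 = m%n<n m 16
  r : Fin 16
  r = fromℕ< m%16<16
  r-odd : m % 16 % 2 ≡ 1
  r-odd = trans (m∣n⇒o%n%m≡o%m 2 16 m (divides 8 refl)) m-odd

odd⇒^[1+4j]%16≡%16 : ∀ m → m % 2 ≡ 1 → ∀ j → m ^ (1 + 4 * j) % 16 ≡ m % 16
odd⇒^[1+4j]%16≡%16 m m-odd j = begin
  m * m ^ (4 * j) % 16                  ≡⟨ cong (λ x → m * x % 16) (sym (^-*-assoc m 4 j)) ⟩
  m * (m ^ 4) ^ j % 16                  ≡⟨ %-distribˡ-* m ((m ^ 4) ^ j) 16 ⟩
  m % 16 * ((m ^ 4) ^ j % 16) % 16      ≡⟨ cong (λ x → m % 16 * x % 16) (%-distribˡ-^ (m ^ 4) j 16) ⟩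
  m % 16 * ((m ^ 4 % 16) ^ j % 16) % 16 ≡⟨ cong (λ x → m % 16 * (x ^ j % 16) % 16) (odd⇒^4%16≡1 m m-odd) ⟩
  m % 16 * (1 ^ j % 16) % 16            ≡⟨ cong (λ x → m % 16 * (x % 16) % 16) (^-zeroˡ j) ⟩
  m % 16 * 1 % 16                       ≡⟨ cong (_% 16) (*-identityʳ (m % 16)) ⟩
  m % 16 % 16                           ≡⟨ m%n%n≡m%n m 16 ⟩
  m % 16                                ∎
  where open ≡-Reasoning

odd⇒^%2≡1 : ∀ m → m % 2 ≡ 1 → ∀ n → m ^ n % 2 ≡ 1
odd⇒^%2≡1 m m-odd n = begin
  m ^ n % 2         ≡⟨ %-distribˡ-^ m n 2 ⟩
  (m % 2) ^ n % 2   ≡⟨ cong (λ x → x ^ n % 2) m-odd ⟩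
  1 ^ n % 2         ≡⟨ cong (_% 2) (^-zeroˡ n) ⟩
  1                 ∎
  where open ≡-Reasoning

∣∸⇒%≡ : ∀ d .{{_ : NonZero d}} {a b} → b ≤ a → d ∣ a ∸ b → a % d ≡ b % d
∣∸⇒%≡ d {a} {b} b≤a d∣a∸b =
  trans (cong (_% d) (sym (m+[n∸m]≡n b≤a))) (%-remove-+ʳ b d∣a∸b)

∣-⇒%≡ : ∀ d .{{_ : NonZero d}} a b → ℤDiv._∣_ (+ d) (+ a - + b) → a % d ≡ b % d
∣-⇒%≡ d a b d∣a-b with ≤-total b a
... | inj₁ b≤a = ∣∸⇒%≡ d b≤a (subst (d ∣_) ∣a-b∣≡a∸b d∣a-b)
  where
  ∣a-b∣≡a∸b : ℤ.∣ + a - + b ∣ ≡ a ∸ b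
  ∣a-b∣≡a∸b = trans (cong ℤ.∣_∣ (ℤ.m-n≡m⊖n a b)) (trans (ℤ.∣m⊖n∣≡∣n⊖m∣ a b) (ℤ.∣⊖∣-≤ b≤a))
... | inj₂ a≤b = sym (∣∸⇒%≡ d a≤b (subst (d ∣_) ∣a-b∣≡b∸a d∣a-b))
  where
  ∣a-b∣≡b∸a : ℤ.∣ + a - + b ∣ ≡ b ∸ a
  ∣a-b∣≡b∸a = trans (cong ℤ.∣_∣ (ℤ.m-n≡m⊖n a b)) (ℤ.∣⊖∣-≤ a≤b)

odd⇒¬4∣2x-4y : ∀ x y → x % 2 ≡ 1 → ¬ ℤDiv._∣_ (+ 4) (+ (2 * x) - + (4 * y))
odd⇒¬4∣2x-4y x y x-odd 4∣2x-4y with trans (sym 2x%4≡2) (trans (∣-⇒%≡ 4 (2 * x) (4 * y) 4∣2x-4y) 4y%4≡0)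
  where
  2x%4≡2 : 2 * x % 4 ≡ 2
  2x%4≡2 = trans (cong (_% 4) (*-comm 2 x)) (trans (sym (m%n*o≡m*o%[n*o] x 2 2)) (cong (_* 2) x-odd))
  4y%4≡0 : 4 * y % 4 ≡ 0
  4y%4≡0 = trans (cong (_% 4) (*-comm 4 y)) (m*n%n≡0 y 4)
... | ()

1<n⇒n%4≡1⇒4≤n : ∀ {n} → 1 < n → n % 4 ≡ 1 → 4 ≤ n
1<n⇒n%4≡1⇒4≤n {suc (suc (suc (suc n)))} _ _ = s≤s (s≤s (s≤s (s≤s z≤n)))
1<n⇒n%4≡1⇒4≤n {suc zero}              (s≤s ()) _
1<n⇒n%4≡1⇒4≤n {suc (suc zero)}        _ ()
1<n⇒n%4≡1⇒4≤n {suc (suc (suc zero))}  _ ()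

lemma3p6 : (p k q : ℕ) → Prime p → p % 4 ≡ 1 → 2 ∣ k → 1 ≤ k →
  Prime q → q % 4 ≡ 1 → (nzq : NonZero q) → LegendreMinusOne p q {{nzq}} →
  (q * q) % 16 ≢ p % 16 → p ^ k < q → q < 2 * p ^ k →
  ¬ (ℤDiv._∣_ (+ 16) (+ (p ^ ceilLog p (q * q)) - + (q * q)))
  × ¬ (ℤDiv._∣_ (+ 16) (+ (2 * p ^ ceilLog p (2 * (q * q))) - + (4 * (q * q))))
lemma3p6 p k q p-prime p%4≡1 (divides j k≡j*2) _ _ _ _ _ q²≢p p^k<q q<2p^k =
    (λ 16∣ → q²≢p (trans (sym (∣-⇒%≡ 16 (p ^ e₁) (q * q) 16∣)) p^e₁≡p))
  , (λ 16∣ → odd⇒¬4∣2x-4y (p ^ e₂) (q * q) (odd⇒^%2≡1 p p-odd e₂) (∣-trans (divides 4 refl) 16∣))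
  where
  open +-*-Solver
  e₁ e₂ : ℕ
  e₁ = ceilLog p (q * q)
  e₂ = ceilLog p (2 * (q * q))
  p-odd : p % 2 ≡ 1
  p-odd = trans (sym (m∣n⇒o%n%m≡o%m 2 4 p (divides 2 refl))) (cong (_% 2) p%4≡1)
  4≤p : 4 ≤ p
  4≤p = 1<n⇒n%4≡1⇒4≤n (nonTrivial⇒n>1 p {{prime⇒nonTrivial p-prime}}) p%4≡1
  k+k≡4j : k + k ≡ 4 * j
  k+k≡4j = trans (cong (λ x → x + x) k≡j*2) (solve 1 (λ j → j :* con 2 :+ j :* con 2 := con 4 :* j) refl j)
  e₁≡1+4j : e₁ ≡ 1 + 4 * j
  e₁≡1+4j = trans (ceilLog-sq p k q 4≤p p^k<q q<2p^k) (cong suc k+k≡4j)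
  p^e₁≡p : p ^ e₁ % 16 ≡ p % 16
  p^e₁≡p = trans (cong (λ e → p ^ e % 16) e₁≡1+4j) (odd⇒^[1+4j]%16≡%16 p p-odd j)
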